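{- For every nonnegative integer $a$ and all positive integers $i,j$, $$\sum_{\ell=0}^{i+a}(-1)^{\ell+j+1}\frac{j-i}{i+a+1}\binom{j+a}{i+a-\ell}\binom{\ell+j+a+1}{\ell}\frac{(a+2)!\,(\ell+j-1)!}{(\ell+j+a+2)!}=(-1)^{i+j}\frac{(j-i)\,(a+i)!\,(a+j)!}{(2a+i+j+2)!}.$$ -}

module Defs where

open import Data.Nat as ℕ using (ℕ; zero; suc; _!)
open import Data.Nat.Properties using (_!≢0)
open import Data.Integer as ℤ using (ℤ; +_)
open import Data.Rational using (ℚ; 0ℚ; _+_; _/_)

sgn : ℕ → ℤ
sgn zero = + 1
sgn (suc n) = ℤ.- sgn n

_/fact_ : ℤ → ℕ → ℚ
z /fact n = _/_ z (n !) {{n !≢0}}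

sumTo : ℕ → (ℕ → ℚ) → ℚ
sumTo zero f = f 0
sumTo (suc n) f = sumTo n f + f (suc n)

module Submission where

-- Put n = i + a, m = j + a and M = n + m + 2, and clear denominators by (n + 1)·M!.  Up to the
-- constant factor (-1)^(j+1)·(j - i), the ℓ-th summand becomes
--   (-1)^ℓ C(m, n - ℓ) C(ℓ + m + 1, ℓ) β(j - 1 + ℓ, a + 2),   β(p, s) = M!·p!·s!/(p + s + 1)!,
-- and β(p, s) is M! times the Beta integral of x^p (1 - x)^s.  Since
-- x^p (1 - x)^s = x^p (1 - x)^(s+1) + x^(p+1) (1 - x)^s, we get β(p, s) = β(p, s + 1) + β(p + 1, s),
-- hence R(p, s + 1) = R(p, s) - R(p + 1, s) for the sums
--   R(p, s) = Σ_ℓ (-1)^ℓ C(m, n - ℓ) C(ℓ + m + 1, ℓ) β(p + ℓ, s).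
-- On the line p + s = m (s ≥ 1) the identity C(ℓ + m + 1, ℓ) β(p + ℓ, s) = C(p + ℓ, ℓ) β(p, s) turns
-- R(p, s) into a multiple of the Chu–Vandermonde sum Σ_ℓ (-1)^ℓ C(p + ℓ, ℓ) C(m, n - ℓ) = C(s - 1, n),
-- which is 0.  So along the line p + s = m + 1 the sums only change sign,
-- R(j - 1, a + 2) = (-1)^(a+1) R(m, 1), and the corner value R(m, 1) = (-1)^n (n + 1)! m! follows
-- from a Wilf–Zeilberger recurrence in n.

open import Defs
open import Data.Nat as ℕ using (ℕ; zero; suc; _≤_; _<_; z≤n; s≤s; _∸_; _!; NonZero)
import Data.Nat.Properties as ℕ
open import Data.Nat.Properties using (_!≢0; _!*_!≢0)
open import Data.Nat.DivMod using (m/n*n≡m)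
open import Data.Nat.Combinatorics using (_C_; k>n⇒nCk≡0; nCk+nC[k+1]≡[n+1]C[k+1]; nCk≡n!/k![n-k]!; k![n∸k]!∣n!; nCn≡1)
open import Data.Integer as ℤ using (ℤ; +_; _+_; -_; _-_)
import Data.Integer.Properties as ℤ
open import Data.Integer.Tactic.RingSolver using (solve-∀)
import Data.Nat.Tactic.RingSolver as NS
open import Algebra.Properties.CommutativeSemigroup ℤ.+-commutativeSemigroup using (interchange)
open import Algebra.Properties.AbelianGroup ℤ.+-0-abelianGroup using (inverseˡ-unique)
open import Data.Rational as ℚ using (ℚ; _*_; _/_; toℚᵘ)
open import Data.Rational.Properties using (toℚᵘ-injective; toℚᵘ-fromℚᵘ; toℚᵘ-homo-*; toℚᵘ-homo-+)
import Data.Rational.Unnormalised as ℚᵘ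
import Data.Rational.Unnormalised.Properties as ℚᵘ
open import Relation.Binary.PropositionalEquality
open import Relation.Binary.Definitions using (tri<; tri≈; tri>)
open ≡-Reasoning

sumℤ : ℕ → (ℕ → ℤ) → ℤ
sumℤ zero f = f 0
sumℤ (suc n) f = sumℤ n f + f (suc n)

sumℤ-cong : ∀ n {f g : ℕ → ℤ} → (∀ l → l ≤ n → f l ≡ g l) → sumℤ n f ≡ sumℤ n g
sumℤ-cong zero f≡g = f≡g 0 z≤n
sumℤ-cong (suc n) f≡g =
  cong₂ _+_ (sumℤ-cong n (λ l l≤n → f≡g l (ℕ.m≤n⇒m≤1+n l≤n))) (f≡g (suc n) ℕ.≤-refl)

sumℤ-distrib-+ : ∀ n (f g : ℕ → ℤ) → sumℤ n (λ l → f l + g l) ≡ sumℤ n f + sumℤ n g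
sumℤ-distrib-+ zero f g = refl
sumℤ-distrib-+ (suc n) f g =
  trans (cong (_+ (f (suc n) + g (suc n))) (sumℤ-distrib-+ n f g))
        (interchange (sumℤ n f) (sumℤ n g) (f (suc n)) (g (suc n)))

sumℤ-*ˡ : ∀ n c (f : ℕ → ℤ) → sumℤ n (λ l → c ℤ.* f l) ≡ c ℤ.* sumℤ n f
sumℤ-*ˡ zero c f = refl
sumℤ-*ˡ (suc n) c f =
  trans (cong (_+ c ℤ.* f (suc n)) (sumℤ-*ˡ n c f)) (sym (ℤ.*-distribˡ-+ c (sumℤ n f) (f (suc n))))

sumℤ-neg : ∀ n (f : ℕ → ℤ) → sumℤ n (λ l → - f l) ≡ - sumℤ n f
sumℤ-neg zero f = refl
sumℤ-neg (suc n) f =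
  trans (cong (_+ - f (suc n)) (sumℤ-neg n f)) (sym (ℤ.neg-distrib-+ (sumℤ n f) (f (suc n))))

sumℤ-distrib‿- : ∀ n (f g : ℕ → ℤ) → sumℤ n (λ l → f l - g l) ≡ sumℤ n f - sumℤ n g
sumℤ-distrib‿- n f g = trans (sumℤ-distrib-+ n f (λ l → - g l)) (cong (_+_ (sumℤ n f)) (sumℤ-neg n g))

sumℤ-unconsˡ : ∀ n (f : ℕ → ℤ) → sumℤ (suc n) f ≡ f 0 + sumℤ n (λ l → f (suc l))
sumℤ-unconsˡ zero f = refl
sumℤ-unconsˡ (suc n) f =
  trans (cong (_+ f (suc (suc n))) (sumℤ-unconsˡ n f)) (ℤ.+-assoc (f 0) _ _)

sumℤ-telescope : ∀ n (h : ℕ → ℤ) → sumℤ n (λ l → h (suc l) - h l) ≡ h (suc n) - h 0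
sumℤ-telescope zero h = refl
sumℤ-telescope (suc n) h =
  trans (cong (_+ (h (suc (suc n)) - h (suc n))) (sumℤ-telescope n h))
        (cancel (h (suc n)) (h 0) (h (suc (suc n))))
  where
    cancel : ∀ a b c → a - b + (c - a) ≡ c - b
    cancel = solve-∀

*-pos-*-swap : ∀ s a x → s ℤ.* + (a ℕ.* x) ≡ + a ℤ.* (s ℤ.* + x)
*-pos-*-swap s a x = trans (cong (ℤ._*_ s) (ℤ.pos-* a x)) (swap s (+ a) (+ x))
  where
    swap : ∀ s a x → s ℤ.* (a ℤ.* x) ≡ a ℤ.* (s ℤ.* x)
    swap = solve-∀

sgn-+ : ∀ a b → sgn (a ℕ.+ b) ≡ sgn a ℤ.* sgn b
sgn-+ zero b = sym (ℤ.*-identityˡ (sgn b))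
sgn-+ (suc a) b = trans (cong -_ (sgn-+ a b)) (ℤ.neg-distribˡ-* (sgn a) (sgn b))

sgn-double : ∀ a → sgn (a ℕ.+ a) ≡ + 1
sgn-double zero = refl
sgn-double (suc a) = trans (cong (λ k → - sgn k) (ℕ.+-suc a a)) (trans (ℤ.neg-involutive (sgn (a ℕ.+ a))) (sgn-double a))

sgn-parity : ∀ i j a → sgn (suc j) ℤ.* sgn (suc a) ℤ.* sgn (i ℕ.+ a) ≡ sgn (i ℕ.+ j)
sgn-parity i j a = begin
  sgn (suc j) ℤ.* sgn (suc a) ℤ.* sgn (i ℕ.+ a) ≡⟨ cong (ℤ._* sgn (i ℕ.+ a)) (sym (sgn-+ (suc j) (suc a))) ⟩
  sgn (suc j ℕ.+ suc a) ℤ.* sgn (i ℕ.+ a)       ≡⟨ sym (sgn-+ (suc j ℕ.+ suc a) (i ℕ.+ a)) ⟩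
  sgn (suc j ℕ.+ suc a ℕ.+ (i ℕ.+ a))           ≡⟨ cong sgn (shuffle i j a) ⟩
  sgn (i ℕ.+ j ℕ.+ (suc a ℕ.+ suc a))           ≡⟨ sgn-+ (i ℕ.+ j) (suc a ℕ.+ suc a) ⟩
  sgn (i ℕ.+ j) ℤ.* sgn (suc a ℕ.+ suc a)       ≡⟨ cong (ℤ._*_ (sgn (i ℕ.+ j))) (sgn-double (suc a)) ⟩
  sgn (i ℕ.+ j) ℤ.* + 1                         ≡⟨ ℤ.*-identityʳ (sgn (i ℕ.+ j)) ⟩
  sgn (i ℕ.+ j) ∎
  where
    shuffle : ∀ i j a → suc j ℕ.+ suc a ℕ.+ (i ℕ.+ a) ≡ i ℕ.+ j ℕ.+ (suc a ℕ.+ suc a)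
    shuffle = NS.solve-∀

C*!*!≡! : ∀ a b → ((a ℕ.+ b) C a) ℕ.* (a ! ℕ.* b !) ≡ (a ℕ.+ b) !
C*!*!≡! a b = begin
  ((a ℕ.+ b) C a) ℕ.* (a ! ℕ.* b !)
    ≡⟨ cong (λ d → ((a ℕ.+ b) C a) ℕ.* (a ! ℕ.* d !)) (sym (ℕ.m+n∸m≡n a b)) ⟩
  ((a ℕ.+ b) C a) ℕ.* (a ! ℕ.* (a ℕ.+ b ∸ a) !)
    ≡⟨ cong (ℕ._* (a ! ℕ.* (a ℕ.+ b ∸ a) !)) (nCk≡n!/k![n-k]! a≤a+b) ⟩
  ((a ℕ.+ b) ! ℕ./ (a ! ℕ.* (a ℕ.+ b ∸ a) !)) ℕ.* (a ! ℕ.* (a ℕ.+ b ∸ a) !)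
    ≡⟨ m/n*n≡m (k![n∸k]!∣n! a≤a+b) ⟩
  (a ℕ.+ b) ! ∎
  where
    a≤a+b = ℕ.m≤m+n a b
    instance _ = a !* (a ℕ.+ b ∸ a) !≢0

*-cancelʳ-!*! : ∀ {x y} a b → x ℕ.* (a ! ℕ.* b !) ≡ y ℕ.* (a ! ℕ.* b !) → x ≡ y
*-cancelʳ-!*! {x} {y} a b = ℕ.*-cancelʳ-≡ x y (a ! ℕ.* b !) {{a !* b !≢0}}

[1+k]*C*!*!≡! : ∀ k m → suc k ℕ.* ((suc k ℕ.+ m) C suc k) ℕ.* (k ! ℕ.* m !) ≡ (suc k ℕ.+ m) !
[1+k]*C*!*!≡! k m = trans (reorder (suc k) ((suc k ℕ.+ m) C suc k) (k !) (m !)) (C*!*!≡! (suc k) m)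
  where
    reorder : ∀ a c f g → a ℕ.* c ℕ.* (f ℕ.* g) ≡ c ℕ.* (a ℕ.* f ℕ.* g)
    reorder = NS.solve-∀

[1+m]*C*!*!≡! : ∀ k m → suc m ℕ.* ((k ℕ.+ suc m) C k) ℕ.* (k ! ℕ.* m !) ≡ (k ℕ.+ suc m) !
[1+m]*C*!*!≡! k m = trans (reorder (suc m) ((k ℕ.+ suc m) C k) (k !) (m !)) (C*!*!≡! k (suc m))
  where
    reorder : ∀ a c f g → a ℕ.* c ℕ.* (f ℕ.* g) ≡ c ℕ.* (f ℕ.* (a ℕ.* g))
    reorder = NS.solve-∀

[1+k+m]*C*!*!≡! : ∀ k m → suc (k ℕ.+ m) ℕ.* ((k ℕ.+ m) C k) ℕ.* (k ! ℕ.* m !) ≡ suc (k ℕ.+ m) !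
[1+k+m]*C*!*!≡! k m =
  trans (ℕ.*-assoc (suc (k ℕ.+ m)) ((k ℕ.+ m) C k) (k ! ℕ.* m !)) (cong (suc (k ℕ.+ m) ℕ.*_) (C*!*!≡! k m))

C-absorption : ∀ k m → suc k ℕ.* ((suc k ℕ.+ m) C suc k) ≡ suc (k ℕ.+ m) ℕ.* ((k ℕ.+ m) C k)
C-absorption k m = *-cancelʳ-!*! k m (trans ([1+k]*C*!*!≡! k m) (sym ([1+k+m]*C*!*!≡! k m)))

C-absorption′ : ∀ k m → suc m ℕ.* ((k ℕ.+ suc m) C k) ≡ suc (k ℕ.+ m) ℕ.* ((k ℕ.+ m) C k)
C-absorption′ k m = *-cancelʳ-!*! k m
  (trans ([1+m]*C*!*!≡! k m) (trans (cong _! (ℕ.+-suc k m)) (sym ([1+k+m]*C*!*!≡! k m))))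

-- (k + 1)·C(m, k + 1) = (m - k)·C(m, k), written without truncated subtraction so that it covers k ≥ m.
C-ratio : ∀ m k → suc k ℕ.* (m C suc k) ℕ.+ k ℕ.* (m C k) ≡ m ℕ.* (m C k)
C-ratio m k with ℕ.<-cmp k m
... | tri< k<m _ _ = subst (λ m → suc k ℕ.* (m C suc k) ℕ.+ k ℕ.* (m C k) ≡ m ℕ.* (m C k))
                          (ℕ.m+[n∸m]≡n k<m) (C-ratio-below k (m ∸ suc k))
  where
    C-ratio-below : ∀ k d → suc k ℕ.* (suc (k ℕ.+ d) C suc k) ℕ.+ k ℕ.* (suc (k ℕ.+ d) C k)
                          ≡ suc (k ℕ.+ d) ℕ.* (suc (k ℕ.+ d) C k)
    C-ratio-below k d = begin
      suc k ℕ.* (suc (k ℕ.+ d) C suc k) ℕ.+ k ℕ.* X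
        ≡⟨ cong (ℕ._+ k ℕ.* X) (*-cancelʳ-!*! k d (trans ([1+k]*C*!*!≡! k d) (sym step))) ⟩
      suc d ℕ.* X ℕ.+ k ℕ.* X
        ≡⟨ sym (ℕ.*-distribʳ-+ X (suc d) k) ⟩
      (suc d ℕ.+ k) ℕ.* X
        ≡⟨ cong (ℕ._* X) (ℕ.+-comm (suc d) k) ⟩
      (k ℕ.+ suc d) ℕ.* X
        ≡⟨ cong (ℕ._* X) (ℕ.+-suc k d) ⟩
      suc (k ℕ.+ d) ℕ.* X ∎
      where
        X = suc (k ℕ.+ d) C k
        step : suc d ℕ.* X ℕ.* (k ! ℕ.* d !) ≡ suc (k ℕ.+ d) !
        step = subst (λ N → suc d ℕ.* (N C k) ℕ.* (k ! ℕ.* d !) ≡ N !) (ℕ.+-suc k d) ([1+m]*C*!*!≡! k d)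
... | tri≈ _ refl _ = cong (ℕ._+ k ℕ.* (k C k)) (trans (cong (suc k ℕ.*_) (k>n⇒nCk≡0 (ℕ.n<1+n k))) (ℕ.*-zeroʳ (suc k)))
... | tri> _ _ m<k = begin
      suc k ℕ.* (m C suc k) ℕ.+ k ℕ.* (m C k)
        ≡⟨ cong₂ (λ x y → suc k ℕ.* x ℕ.+ k ℕ.* y) (k>n⇒nCk≡0 (ℕ.m<n⇒m<1+n m<k)) (k>n⇒nCk≡0 m<k) ⟩
      suc k ℕ.* 0 ℕ.+ k ℕ.* 0
        ≡⟨ cong₂ ℕ._+_ (ℕ.*-zeroʳ (suc k)) (ℕ.*-zeroʳ k) ⟩
      0
        ≡⟨ sym (ℕ.*-zeroʳ m) ⟩
      m ℕ.* 0
        ≡⟨ cong (m ℕ.*_) (sym (k>n⇒nCk≡0 m<k)) ⟩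
      m ℕ.* (m C k) ∎

rising : ℕ → ℕ → ℕ
rising x zero = 1
rising x (suc k) = suc x ℕ.* rising (suc x) k

!*rising≡! : ∀ x k → x ! ℕ.* rising x k ≡ (x ℕ.+ k) !
!*rising≡! x zero = trans (ℕ.*-identityʳ (x !)) (cong _! (sym (ℕ.+-identityʳ x)))
!*rising≡! x (suc k) = begin
  x ! ℕ.* (suc x ℕ.* rising (suc x) k) ≡⟨ sym (ℕ.*-assoc (x !) (suc x) _) ⟩
  x ! ℕ.* suc x ℕ.* rising (suc x) k   ≡⟨ cong (ℕ._* rising (suc x) k) (ℕ.*-comm (x !) (suc x)) ⟩
  suc x ! ℕ.* rising (suc x) k         ≡⟨ !*rising≡! (suc x) k ⟩
  (suc x ℕ.+ k) !                      ≡⟨ cong _! (sym (ℕ.+-suc x k)) ⟩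
  (x ℕ.+ suc k) ! ∎

-- y !/ x is the integer y!/x! = (x + 1)⋯y; for y < x it is the junk value 1.
_!/_ : ℕ → ℕ → ℕ
y !/ x = rising x (y ∸ x)

!*!/≡! : ∀ {x y} → x ≤ y → x ! ℕ.* (y !/ x) ≡ y !
!*!/≡! {x} {y} x≤y = trans (!*rising≡! x (y ∸ x)) (cong _! (ℕ.m+[n∸m]≡n x≤y))

!/-unfold : ∀ {x y} → x < y → y !/ x ≡ suc x ℕ.* (y !/ suc x)
!/-unfold {x} x<y = cong (rising x) (ℕ.+-∸-assoc 1 x<y)

!/-diagonal : ∀ y → y !/ y ≡ 1
!/-diagonal y = cong (rising y) (ℕ.n∸n≡0 y)

-- Since (-1)^l C(p + l, l) = C(-p - 1, l), this is the Chu–Vandermonde convolution for C(M - p - 1, n).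
negVandermonde : ℕ → ℕ → ℕ → ℤ
negVandermonde M p n = sumℤ n (λ l → sgn l ℤ.* + (M C (n ∸ l)) ℤ.* + ((p ℕ.+ l) C l))

negVandermonde-zero-suc : ∀ M n → negVandermonde M 0 (suc n) ≡ + (M C suc n) - negVandermonde M 0 n
negVandermonde-zero-suc M n = begin
  negVandermonde M 0 (suc n)
    ≡⟨ sumℤ-unconsˡ n _ ⟩
  + 1 ℤ.* + (M C suc n) ℤ.* + 1 + sumℤ n (λ l → - sgn l ℤ.* X l ℤ.* + (suc l C suc l))
    ≡⟨ cong₂ _+_ (unit (+ (M C suc n))) (sumℤ-cong n (λ l _ → diagonal l)) ⟩
  + (M C suc n) + sumℤ n (λ l → - (sgn l ℤ.* X l ℤ.* + (l C l)))
    ≡⟨ cong (_+_ (+ (M C suc n))) (sumℤ-neg n _) ⟩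
  + (M C suc n) - negVandermonde M 0 n ∎
  where
    X : ℕ → ℤ
    X l = + (M C (n ∸ l))
    unit : ∀ x → + 1 ℤ.* x ℤ.* + 1 ≡ x
    unit = solve-∀
    neg-first : ∀ s x c → - s ℤ.* x ℤ.* c ≡ - (s ℤ.* x ℤ.* c)
    neg-first = solve-∀
    diagonal : ∀ l → - sgn l ℤ.* X l ℤ.* + (suc l C suc l) ≡ - (sgn l ℤ.* X l ℤ.* + (l C l))
    diagonal l = trans (cong (λ c → - sgn l ℤ.* X l ℤ.* + c) (trans (nCn≡1 (suc l)) (sym (nCn≡1 l))))
                       (neg-first (sgn l) (X l) (+ (l C l)))

negVandermonde-suc-suc : ∀ M p n →
  negVandermonde M (suc p) (suc n) ≡ negVandermonde M p (suc n) - negVandermonde M (suc p) n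
negVandermonde-suc-suc M p n = begin
  negVandermonde M (suc p) (suc n)
    ≡⟨ sumℤ-unconsˡ n _ ⟩
  c + sumℤ n (λ l → - sgn l ℤ.* X l ℤ.* + ((suc p ℕ.+ suc l) C suc l))
    ≡⟨ cong (_+_ c) (sumℤ-cong n (λ l _ → pascal l)) ⟩
  c + sumℤ n (λ l → - u l + v l)
    ≡⟨ cong (_+_ c) (trans (sumℤ-distrib-+ n _ v) (cong (_+ sumℤ n v) (sumℤ-neg n u))) ⟩
  c + (- negVandermonde M (suc p) n + sumℤ n v)
    ≡⟨ reorder c (negVandermonde M (suc p) n) (sumℤ n v) ⟩
  (c + sumℤ n v) - negVandermonde M (suc p) n
    ≡⟨ cong (_- negVandermonde M (suc p) n) (sym (sumℤ-unconsˡ n _)) ⟩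
  negVandermonde M p (suc n) - negVandermonde M (suc p) n ∎
  where
    c = + 1 ℤ.* + (M C suc n) ℤ.* + 1
    X u v : ℕ → ℤ
    X l = + (M C (n ∸ l))
    u l = sgn l ℤ.* X l ℤ.* + ((suc p ℕ.+ l) C l)
    v l = - sgn l ℤ.* X l ℤ.* + ((p ℕ.+ suc l) C suc l)
    reorder : ∀ c g s → c + (- g + s) ≡ (c + s) - g
    reorder = solve-∀
    split : ∀ s x a b → - s ℤ.* x ℤ.* (a + b) ≡ - (s ℤ.* x ℤ.* a) + - s ℤ.* x ℤ.* b
    split = solve-∀
    pascal : ∀ l → - sgn l ℤ.* X l ℤ.* + ((suc p ℕ.+ suc l) C suc l) ≡ - u l + v l
    pascal l = begin
      - sgn l ℤ.* X l ℤ.* + (suc (p ℕ.+ suc l) C suc l)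
        ≡⟨ cong (λ c → - sgn l ℤ.* X l ℤ.* + c) (sym (nCk+nC[k+1]≡[n+1]C[k+1] (p ℕ.+ suc l) l)) ⟩
      - sgn l ℤ.* X l ℤ.* + ((p ℕ.+ suc l) C l ℕ.+ (p ℕ.+ suc l) C suc l)
        ≡⟨ cong (λ c → - sgn l ℤ.* X l ℤ.* c) (ℤ.pos-+ ((p ℕ.+ suc l) C l) _) ⟩
      - sgn l ℤ.* X l ℤ.* (+ ((p ℕ.+ suc l) C l) + + ((p ℕ.+ suc l) C suc l))
        ≡⟨ split (sgn l) (X l) _ _ ⟩
      - (sgn l ℤ.* X l ℤ.* + ((p ℕ.+ suc l) C l)) + v l
        ≡⟨ cong (λ k → - (sgn l ℤ.* X l ℤ.* + (k C l)) + v l) (ℕ.+-suc p l) ⟩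
      - u l + v l ∎

pascal-sub : ∀ t n → + (suc t C suc n) - + (t C n) ≡ + (t C suc n)
pascal-sub t n = begin
  + (suc t C suc n) - + (t C n)                     ≡⟨ cong (λ c → + c - + (t C n)) (sym (nCk+nC[k+1]≡[n+1]C[k+1] t n)) ⟩
  + (t C n ℕ.+ t C suc n) - + (t C n)               ≡⟨ cong (_- + (t C n)) (ℤ.pos-+ (t C n) (t C suc n)) ⟩
  + (t C n) + + (t C suc n) - + (t C n)             ≡⟨ cancel (+ (t C n)) (+ (t C suc n)) ⟩
  + (t C suc n) ∎
  where
    cancel : ∀ a b → a + b - a ≡ b
    cancel = solve-∀

negVandermonde-closed : ∀ p t n → negVandermonde (suc (p ℕ.+ t)) p n ≡ + (t C n)
negVandermonde-closed p t zero = refl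
negVandermonde-closed zero t (suc n) = begin
  negVandermonde (suc t) 0 (suc n)             ≡⟨ negVandermonde-zero-suc (suc t) n ⟩
  + (suc t C suc n) - negVandermonde (suc t) 0 n ≡⟨ cong (_-_ (+ (suc t C suc n))) (negVandermonde-closed 0 t n) ⟩
  + (suc t C suc n) - + (t C n)                 ≡⟨ pascal-sub t n ⟩
  + (t C suc n) ∎
negVandermonde-closed (suc p) t (suc n) = begin
  negVandermonde M (suc p) (suc n)
    ≡⟨ negVandermonde-suc-suc M p n ⟩
  negVandermonde M p (suc n) - negVandermonde M (suc p) n
    ≡⟨ cong₂ _-_ (trans (cong (λ k → negVandermonde (suc k) p (suc n)) (sym (ℕ.+-suc p t)))
                        (negVandermonde-closed p (suc t) (suc n)))
                 (negVandermonde-closed (suc p) t n) ⟩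
  + (suc t C suc n) - + (t C n)
    ≡⟨ pascal-sub t n ⟩
  + (t C suc n) ∎
  where M = suc (suc p ℕ.+ t)

-- M! times the Beta integral ∫₀¹ x^p (1 - x)^s dx.
β : ℕ → ℕ → ℕ → ℕ
β M p s = p ! ℕ.* s ! ℕ.* (M !/ suc (p ℕ.+ s))

β-step : ∀ M p s → suc (suc (p ℕ.+ s)) ≤ M → β M p s ≡ β M p (suc s) ℕ.+ β M (suc p) s
β-step M p s p+s+2≤M = begin
  p ! ℕ.* s ! ℕ.* (M !/ suc (p ℕ.+ s))
    ≡⟨ cong (p ! ℕ.* s ! ℕ.*_) (!/-unfold p+s+2≤M) ⟩
  p ! ℕ.* s ! ℕ.* (suc (suc (p ℕ.+ s)) ℕ.* ρ)
    ≡⟨ split (p !) (s !) p s ρ ⟩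
  p ! ℕ.* suc s ! ℕ.* ρ ℕ.+ suc p ! ℕ.* s ! ℕ.* ρ
    ≡⟨ cong (λ k → p ! ℕ.* suc s ! ℕ.* (M !/ suc k) ℕ.+ β M (suc p) s) (sym (ℕ.+-suc p s)) ⟩
  β M p (suc s) ℕ.+ β M (suc p) s ∎
  where
    ρ = M !/ suc (suc (p ℕ.+ s))
    split : ∀ f g p s ρ → f ℕ.* g ℕ.* (suc (suc (p ℕ.+ s)) ℕ.* ρ)
                        ≡ f ℕ.* (suc s ℕ.* g) ℕ.* ρ ℕ.+ suc p ℕ.* f ℕ.* g ℕ.* ρ
    split = NS.solve-∀

C*β-shift : ∀ M l p s → suc (p ℕ.+ l ℕ.+ s) ≤ M →
  ((l ℕ.+ suc (p ℕ.+ s)) C l) ℕ.* β M (p ℕ.+ l) s ≡ ((p ℕ.+ l) C l) ℕ.* β M p s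
C*β-shift M l p s bound = *-cancelʳ-!*! l (suc (p ℕ.+ s)) (trans lhs (sym rhs))
  where
    ρ = M !/ suc (p ℕ.+ s)
    ρ′ = M !/ suc (p ℕ.+ l ℕ.+ s)
    F = (p ℕ.+ l) ! ℕ.* s ! ℕ.* M !
    lhs : ((l ℕ.+ suc (p ℕ.+ s)) C l) ℕ.* β M (p ℕ.+ l) s ℕ.* (l ! ℕ.* suc (p ℕ.+ s) !) ≡ F
    lhs = begin
      ((l ℕ.+ suc (p ℕ.+ s)) C l) ℕ.* ((p ℕ.+ l) ! ℕ.* s ! ℕ.* ρ′) ℕ.* (l ! ℕ.* suc (p ℕ.+ s) !)
        ≡⟨ reorder₁ ((l ℕ.+ suc (p ℕ.+ s)) C l) ((p ℕ.+ l) !) (s !) ρ′ (l !) (suc (p ℕ.+ s) !) ⟩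
      (p ℕ.+ l) ! ℕ.* s ! ℕ.* (((l ℕ.+ suc (p ℕ.+ s)) C l) ℕ.* (l ! ℕ.* suc (p ℕ.+ s) !) ℕ.* ρ′)
        ≡⟨ cong (λ x → (p ℕ.+ l) ! ℕ.* s ! ℕ.* (x ℕ.* ρ′)) (C*!*!≡! l (suc (p ℕ.+ s))) ⟩
      (p ℕ.+ l) ! ℕ.* s ! ℕ.* ((l ℕ.+ suc (p ℕ.+ s)) ! ℕ.* ρ′)
        ≡⟨ cong (λ k → (p ℕ.+ l) ! ℕ.* s ! ℕ.* (k ! ℕ.* ρ′)) (shuffle l p s) ⟩
      (p ℕ.+ l) ! ℕ.* s ! ℕ.* (suc (p ℕ.+ l ℕ.+ s) ! ℕ.* ρ′)
        ≡⟨ cong ((p ℕ.+ l) ! ℕ.* s ! ℕ.*_) (!*!/≡! bound) ⟩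
      F ∎
      where
        reorder₁ : ∀ c f g ρ a b → c ℕ.* (f ℕ.* g ℕ.* ρ) ℕ.* (a ℕ.* b) ≡ f ℕ.* g ℕ.* (c ℕ.* (a ℕ.* b) ℕ.* ρ)
        reorder₁ = NS.solve-∀
        shuffle : ∀ l p s → l ℕ.+ suc (p ℕ.+ s) ≡ suc (p ℕ.+ l ℕ.+ s)
        shuffle = NS.solve-∀
    rhs : ((p ℕ.+ l) C l) ℕ.* β M p s ℕ.* (l ! ℕ.* suc (p ℕ.+ s) !) ≡ F
    rhs = begin
      ((p ℕ.+ l) C l) ℕ.* (p ! ℕ.* s ! ℕ.* ρ) ℕ.* (l ! ℕ.* suc (p ℕ.+ s) !)
        ≡⟨ reorder₂ ((p ℕ.+ l) C l) (p !) (s !) ρ (l !) (suc (p ℕ.+ s) !) ⟩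
      ((p ℕ.+ l) C l) ℕ.* (l ! ℕ.* p !) ℕ.* s ! ℕ.* (suc (p ℕ.+ s) ! ℕ.* ρ)
        ≡⟨ cong₂ (λ x y → x ℕ.* s ! ℕ.* y) p+lCl*l!*p!≡[p+l]! (!*!/≡! (ℕ.≤-trans p+s<p+l+s bound)) ⟩
      F ∎
      where
        reorder₂ : ∀ c f g ρ a b → c ℕ.* (f ℕ.* g ℕ.* ρ) ℕ.* (a ℕ.* b) ≡ c ℕ.* (a ℕ.* f) ℕ.* g ℕ.* (b ℕ.* ρ)
        reorder₂ = NS.solve-∀
        p+lCl*l!*p!≡[p+l]! : ((p ℕ.+ l) C l) ℕ.* (l ! ℕ.* p !) ≡ (p ℕ.+ l) !
        p+lCl*l!*p!≡[p+l]! = subst (λ k → (k C l) ℕ.* (l ! ℕ.* p !) ≡ k !) (ℕ.+-comm l p) (C*!*!≡! l p)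
        p+s<p+l+s : suc (p ℕ.+ s) ≤ suc (p ℕ.+ l ℕ.+ s)
        p+s<p+l+s = s≤s (ℕ.+-monoˡ-≤ s (ℕ.m≤m+n p l))

betaSum : ℕ → (ℕ → ℤ) → ℕ → ℕ → ℕ → ℤ
betaSum M c n p s = sumℤ n (λ l → c l ℤ.* + β M (p ℕ.+ l) s)

betaSum-step : ∀ M c n p s → suc (suc (p ℕ.+ n ℕ.+ s)) ≤ M →
  betaSum M c n p (suc s) ≡ betaSum M c n p s - betaSum M c n (suc p) s
betaSum-step M c n p s bound =
  trans (sumℤ-cong n termwise) (sumℤ-distrib‿- n (λ l → c l ℤ.* + β M (p ℕ.+ l) s) (λ l → c l ℤ.* + β M (suc p ℕ.+ l) s))
  where
    split : ∀ c x y → c ℤ.* x ≡ c ℤ.* (x + y) - c ℤ.* y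
    split = solve-∀
    termwise : ∀ l → l ≤ n → c l ℤ.* + β M (p ℕ.+ l) (suc s) ≡ c l ℤ.* + β M (p ℕ.+ l) s - c l ℤ.* + β M (suc p ℕ.+ l) s
    termwise l l≤n = begin
      c l ℤ.* + β M (p ℕ.+ l) (suc s)
        ≡⟨ split (c l) _ _ ⟩
      c l ℤ.* (+ β M (p ℕ.+ l) (suc s) + + β M (suc p ℕ.+ l) s) - c l ℤ.* + β M (suc p ℕ.+ l) s
        ≡⟨ cong (λ x → c l ℤ.* x - c l ℤ.* + β M (suc p ℕ.+ l) s) (sym (ℤ.pos-+ (β M (p ℕ.+ l) (suc s)) (β M (suc p ℕ.+ l) s))) ⟩
      c l ℤ.* + (β M (p ℕ.+ l) (suc s) ℕ.+ β M (suc p ℕ.+ l) s) - c l ℤ.* + β M (suc p ℕ.+ l) s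
        ≡⟨ cong (λ x → c l ℤ.* + x - c l ℤ.* + β M (suc p ℕ.+ l) s) (sym (β-step M (p ℕ.+ l) s (ℕ.≤-trans p+l+s≤p+n+s bound))) ⟩
      c l ℤ.* + β M (p ℕ.+ l) s - c l ℤ.* + β M (suc p ℕ.+ l) s ∎
      where
        p+l+s≤p+n+s : suc (suc (p ℕ.+ l ℕ.+ s)) ≤ suc (suc (p ℕ.+ n ℕ.+ s))
        p+l+s≤p+n+s = s≤s (s≤s (ℕ.+-monoˡ-≤ s (ℕ.+-monoʳ-≤ p l≤n)))

-- The two sides differ by (2l + k + m + 3)·((k + 1)·Y + k·X - m·X).
wz-identity : ∀ n l k m X Y → n ≡ l ℕ.+ k → suc k ℕ.* Y ℕ.+ k ℕ.* X ≡ m ℕ.* X →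
  suc n ℕ.* (suc (suc (suc (n ℕ.+ m))) ℕ.* Y ℕ.+ suc (suc n) ℕ.* X)
    ≡ suc (suc (l ℕ.+ m)) ℕ.* (suc (l ℕ.+ m) ℕ.* X ℕ.+ l ℕ.* Y)
wz-identity _ l k m X Y refl ratio = ℕ.+-cancelʳ-≡ _ _ _ (begin
  lhs ℕ.+ w ℕ.* (m ℕ.* X)                        ≡⟨ expand l k m X Y ⟩
  rhs ℕ.+ w ℕ.* (suc k ℕ.* Y ℕ.+ k ℕ.* X)        ≡⟨ cong (λ x → rhs ℕ.+ w ℕ.* x) ratio ⟩
  rhs ℕ.+ w ℕ.* (m ℕ.* X) ∎)
  where
    lhs = suc (l ℕ.+ k) ℕ.* (suc (suc (suc (l ℕ.+ k ℕ.+ m))) ℕ.* Y ℕ.+ suc (suc (l ℕ.+ k)) ℕ.* X)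
    rhs = suc (suc (l ℕ.+ m)) ℕ.* (suc (l ℕ.+ m) ℕ.* X ℕ.+ l ℕ.* Y)
    w = 3 ℕ.+ 2 ℕ.* l ℕ.+ k ℕ.+ m
    expand : ∀ l k m X Y →
      suc (l ℕ.+ k) ℕ.* (suc (suc (suc (l ℕ.+ k ℕ.+ m))) ℕ.* Y ℕ.+ suc (suc (l ℕ.+ k)) ℕ.* X)
        ℕ.+ (3 ℕ.+ 2 ℕ.* l ℕ.+ k ℕ.+ m) ℕ.* (m ℕ.* X)
      ≡ suc (suc (l ℕ.+ m)) ℕ.* (suc (l ℕ.+ m) ℕ.* X ℕ.+ l ℕ.* Y)
        ℕ.+ (3 ℕ.+ 2 ℕ.* l ℕ.+ k ℕ.+ m) ℕ.* (suc k ℕ.* Y ℕ.+ k ℕ.* X)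
    expand = NS.solve-∀

module WZ (m L : ℕ) where

  P : ℕ → ℕ
  P l = (l ℕ.+ m) C l

  -- w l = L!/(l + m + 2)
  w : ℕ → ℕ
  w l = suc (l ℕ.+ m) ! ℕ.* (L !/ suc (suc (l ℕ.+ m)))

  term : ℕ → ℕ → ℕ
  term n l = (m C (n ∸ l)) ℕ.* P l ℕ.* w l

  cert : ℕ → ℕ → ℕ
  cert n l = (m C (suc n ∸ l)) ℕ.* P l ℕ.* l ℕ.* L !

  z : ℕ → ℕ → ℤ
  z n l = sgn l ℤ.* + term n l

  h : ℕ → ℕ → ℤ
  h n l = sgn (suc l) ℤ.* + cert n l

  Z : ℕ → ℤ
  Z n = sumℤ n (z n)

  w-spec : ∀ l → suc (suc (l ℕ.+ m)) ≤ L → suc (suc (l ℕ.+ m)) ℕ.* w l ≡ L !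
  w-spec l bound = trans (sym (ℕ.*-assoc (suc (suc (l ℕ.+ m))) (suc (l ℕ.+ m) !) _)) (!*!/≡! bound)

  wz-pointwise : ∀ n l → l ≤ n → suc (suc (n ℕ.+ m)) ≤ L →
    suc n ℕ.* (suc (suc (suc (n ℕ.+ m))) ℕ.* term (suc n) l ℕ.+ suc (suc n) ℕ.* term n l)
      ≡ cert n (suc l) ℕ.+ cert n l
  wz-pointwise n l l≤n bound = begin
    suc n ℕ.* (a ℕ.* (Y ℕ.* P l ℕ.* w l) ℕ.+ b ℕ.* (X ℕ.* P l ℕ.* w l))
      ≡⟨ factor (suc n) a b X Y (P l) (w l) ⟩
    P l ℕ.* w l ℕ.* (suc n ℕ.* (a ℕ.* Y ℕ.+ b ℕ.* X))
      ≡⟨ cong (P l ℕ.* w l ℕ.*_) (wz-identity n l k m X Y (sym (ℕ.m+[n∸m]≡n l≤n)) ratio) ⟩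
    P l ℕ.* w l ℕ.* (suc (suc (l ℕ.+ m)) ℕ.* (suc (l ℕ.+ m) ℕ.* X ℕ.+ l ℕ.* Y))
      ≡⟨ distribute (P l) (w l) (suc (suc (l ℕ.+ m))) (suc (l ℕ.+ m)) l X Y ⟩
    X ℕ.* (suc (l ℕ.+ m) ℕ.* P l) ℕ.* (suc (suc (l ℕ.+ m)) ℕ.* w l) ℕ.+ Y ℕ.* P l ℕ.* l ℕ.* (suc (suc (l ℕ.+ m)) ℕ.* w l)
      ≡⟨ cong₂ (λ x y → X ℕ.* x ℕ.* y ℕ.+ Y ℕ.* P l ℕ.* l ℕ.* y) (sym (C-absorption l m)) (w-spec l l+m+2≤L) ⟩
    X ℕ.* (suc l ℕ.* P (suc l)) ℕ.* L ! ℕ.+ Y ℕ.* P l ℕ.* l ℕ.* L !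
      ≡⟨ cong (ℕ._+ cert n l) (reassoc X (suc l) (P (suc l)) (L !)) ⟩
    cert n (suc l) ℕ.+ cert n l ∎
    where
      a = suc (suc (suc (n ℕ.+ m)))
      b = suc (suc n)
      k = n ∸ l
      X = m C k
      Y = m C (suc n ∸ l)
      ratio : suc k ℕ.* Y ℕ.+ k ℕ.* X ≡ m ℕ.* X
      ratio = subst (λ j → suc k ℕ.* (m C j) ℕ.+ k ℕ.* X ≡ m ℕ.* X) (sym (ℕ.+-∸-assoc 1 l≤n)) (C-ratio m k)
      l+m+2≤L : suc (suc (l ℕ.+ m)) ≤ L
      l+m+2≤L = ℕ.≤-trans (s≤s (s≤s (ℕ.+-monoˡ-≤ m l≤n))) bound
      factor : ∀ c a b X Y p v → c ℕ.* (a ℕ.* (Y ℕ.* p ℕ.* v) ℕ.+ b ℕ.* (X ℕ.* p ℕ.* v))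
                                 ≡ p ℕ.* v ℕ.* (c ℕ.* (a ℕ.* Y ℕ.+ b ℕ.* X))
      factor = NS.solve-∀
      distribute : ∀ p v d e l X Y → p ℕ.* v ℕ.* (d ℕ.* (e ℕ.* X ℕ.+ l ℕ.* Y))
                                     ≡ X ℕ.* (e ℕ.* p) ℕ.* (d ℕ.* v) ℕ.+ Y ℕ.* p ℕ.* l ℕ.* (d ℕ.* v)
      distribute = NS.solve-∀
      reassoc : ∀ X s p f → X ℕ.* (s ℕ.* p) ℕ.* f ≡ X ℕ.* p ℕ.* s ℕ.* f
      reassoc = NS.solve-∀

  boundary : ∀ n → suc (suc (suc (n ℕ.+ m))) ≤ L →
    suc n ℕ.* (suc (suc (suc (n ℕ.+ m))) ℕ.* term (suc n) (suc n)) ≡ cert n (suc n)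
  boundary n bound = trans (reorder (suc n) (suc (suc (suc (n ℕ.+ m)))) (m C (n ∸ n)) (P (suc n)) (w (suc n)))
                           (cong ((m C (n ∸ n)) ℕ.* P (suc n) ℕ.* suc n ℕ.*_) (w-spec (suc n) bound))
    where
      reorder : ∀ c a X p v → c ℕ.* (a ℕ.* (X ℕ.* p ℕ.* v)) ≡ X ℕ.* p ℕ.* c ℕ.* (a ℕ.* v)
      reorder = NS.solve-∀

  wz-pointwise-signed : ∀ n l → l ≤ n → suc (suc (n ℕ.+ m)) ≤ L →
    + suc n ℤ.* (+ suc (suc (suc (n ℕ.+ m))) ℤ.* z (suc n) l + + suc (suc n) ℤ.* z n l) ≡ h n (suc l) - h n l
  wz-pointwise-signed n l l≤n bound = begin
    + suc n ℤ.* (+ a ℤ.* (sgn l ℤ.* + term (suc n) l) + + b ℤ.* (sgn l ℤ.* + term n l))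
      ≡⟨ cast (sgn l) (suc n) a (term (suc n) l) b (term n l) ⟩
    sgn l ℤ.* + (suc n ℕ.* (a ℕ.* term (suc n) l ℕ.+ b ℕ.* term n l))
      ≡⟨ cong (λ x → sgn l ℤ.* + x) (wz-pointwise n l l≤n bound) ⟩
    sgn l ℤ.* + (cert n (suc l) ℕ.+ cert n l)
      ≡⟨ cong (ℤ._*_ (sgn l)) (ℤ.pos-+ (cert n (suc l)) (cert n l)) ⟩
    sgn l ℤ.* (+ cert n (suc l) + + cert n l)
      ≡⟨ signs (sgn l) (+ cert n (suc l)) (+ cert n l) ⟩
    h n (suc l) - h n l ∎
    where
      a = suc (suc (suc (n ℕ.+ m)))
      b = suc (suc n)
      signs : ∀ s x y → s ℤ.* (x + y) ≡ - - s ℤ.* x - - s ℤ.* y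
      signs = solve-∀
      cast : ∀ s c a x b y → + c ℤ.* (+ a ℤ.* (s ℤ.* + x) + + b ℤ.* (s ℤ.* + y)) ≡ s ℤ.* + (c ℕ.* (a ℕ.* x ℕ.+ b ℕ.* y))
      cast s c a x b y = trans (swap s (+ c) (+ a) (+ x) (+ b) (+ y)) (cong (ℤ._*_ s) (sym (begin
        + (c ℕ.* (a ℕ.* x ℕ.+ b ℕ.* y))           ≡⟨ ℤ.pos-* c _ ⟩
        + c ℤ.* + (a ℕ.* x ℕ.+ b ℕ.* y)           ≡⟨ cong (ℤ._*_ (+ c)) (ℤ.pos-+ (a ℕ.* x) (b ℕ.* y)) ⟩
        + c ℤ.* (+ (a ℕ.* x) + + (b ℕ.* y))       ≡⟨ cong (ℤ._*_ (+ c)) (cong₂ _+_ (ℤ.pos-* a x) (ℤ.pos-* b y)) ⟩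
        + c ℤ.* (+ a ℤ.* + x + + b ℤ.* + y) ∎)))
        where
          swap : ∀ s c a x b y → c ℤ.* (a ℤ.* (s ℤ.* x) + b ℤ.* (s ℤ.* y)) ≡ s ℤ.* (c ℤ.* (a ℤ.* x + b ℤ.* y))
          swap = solve-∀

  boundary-signed : ∀ n → suc (suc (suc (n ℕ.+ m))) ≤ L →
    h n (suc n) + + suc n ℤ.* (+ suc (suc (suc (n ℕ.+ m))) ℤ.* z (suc n) (suc n)) ≡ + 0
  boundary-signed n bound = begin
    h n (suc n) + + suc n ℤ.* (+ a ℤ.* (sgn (suc n) ℤ.* + term (suc n) (suc n)))
      ≡⟨ cong (_+_ (h n (suc n))) (sym (trans (*-pos-*-swap (sgn (suc n)) (suc n) _) (cong (ℤ._*_ (+ suc n)) (*-pos-*-swap (sgn (suc n)) a _)))) ⟩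
    h n (suc n) + sgn (suc n) ℤ.* + (suc n ℕ.* (a ℕ.* term (suc n) (suc n)))
      ≡⟨ cong (λ x → h n (suc n) + sgn (suc n) ℤ.* + x) (boundary n bound) ⟩
    - sgn (suc n) ℤ.* + cert n (suc n) + sgn (suc n) ℤ.* + cert n (suc n)
      ≡⟨ cancel (sgn (suc n)) (+ cert n (suc n)) ⟩
    + 0 ∎
    where
      a = suc (suc (suc (n ℕ.+ m)))
      cancel : ∀ s x → - s ℤ.* x + s ℤ.* x ≡ + 0
      cancel = solve-∀

  h-zero : ∀ n → h n 0 ≡ + 0
  h-zero n = trans (cong (λ x → sgn 1 ℤ.* + x) (cong (ℕ._* L !) (ℕ.*-zeroʳ ((m C suc n) ℕ.* P 0)))) (ℤ.*-zeroʳ (sgn 1))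

  Z-recurrence : ∀ n → suc (suc (suc (n ℕ.+ m))) ≤ L →
    + suc (suc (suc (n ℕ.+ m))) ℤ.* Z (suc n) + + suc (suc n) ℤ.* Z n ≡ + 0
  Z-recurrence n bound = ℤ.*-cancelˡ-≡ (+ suc n) _ _ (begin
    + suc n ℤ.* (+ a ℤ.* (sumℤ n (z (suc n)) + z (suc n) (suc n)) + + b ℤ.* Z n)
      ≡⟨ regroup (+ suc n) (+ a) (+ b) (sumℤ n (z (suc n))) (z (suc n) (suc n)) (Z n) ⟩
    + suc n ℤ.* (+ a ℤ.* sumℤ n (z (suc n)) + + b ℤ.* Z n) + last
      ≡⟨ cong (_+ last) (sym bulk) ⟩
    sumℤ n (λ l → + suc n ℤ.* (+ a ℤ.* z (suc n) l + + b ℤ.* z n l)) + last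
      ≡⟨ cong (_+ last) (sumℤ-cong n (λ l l≤n → wz-pointwise-signed n l l≤n (ℕ.≤-trans (ℕ.n≤1+n _) bound))) ⟩
    sumℤ n (λ l → h n (suc l) - h n l) + last
      ≡⟨ cong (_+ last) (sumℤ-telescope n (h n)) ⟩
    h n (suc n) - h n 0 + last
      ≡⟨ cong (λ x → h n (suc n) - x + last) (h-zero n) ⟩
    h n (suc n) - + 0 + last
      ≡⟨ cong (_+ last) (ℤ.+-identityʳ (h n (suc n))) ⟩
    h n (suc n) + last
      ≡⟨ boundary-signed n bound ⟩
    + 0
      ≡⟨ sym (ℤ.*-zeroʳ (+ suc n)) ⟩
    + suc n ℤ.* + 0 ∎)
    where
      a = suc (suc (suc (n ℕ.+ m)))
      b = suc (suc n)
      last = + suc n ℤ.* (+ a ℤ.* z (suc n) (suc n))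
      regroup : ∀ c a b s z t → c ℤ.* (a ℤ.* (s + z) + b ℤ.* t) ≡ c ℤ.* (a ℤ.* s + b ℤ.* t) + c ℤ.* (a ℤ.* z)
      regroup = solve-∀
      bulk : sumℤ n (λ l → + suc n ℤ.* (+ a ℤ.* z (suc n) l + + b ℤ.* z n l))
             ≡ + suc n ℤ.* (+ a ℤ.* sumℤ n (z (suc n)) + + b ℤ.* Z n)
      bulk = trans (sumℤ-*ˡ n (+ suc n) _)
                   (cong (ℤ._*_ (+ suc n)) (trans (sumℤ-distrib-+ n _ _) (cong₂ _+_ (sumℤ-*ˡ n (+ a) _) (sumℤ-*ˡ n (+ b) _))))

  closed : ℕ → ℕ
  closed n = suc n ! ℕ.* suc m ! ℕ.* (L !/ suc (suc (n ℕ.+ m)))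

  Z-closed : ∀ n → suc (suc (n ℕ.+ m)) ≤ L → Z n ≡ sgn n ℤ.* + closed n
  Z-closed zero _ = cong (λ x → + 1 ℤ.* + x) (unit (suc m !) (L !/ suc (suc m)))
    where
      unit : ∀ x y → 1 ℕ.* 1 ℕ.* (x ℕ.* y) ≡ 1 ℕ.* x ℕ.* y
      unit = NS.solve-∀
  Z-closed (suc n) bound = ℤ.*-cancelˡ-≡ (+ a) _ _ (begin
    + a ℤ.* Z (suc n)                   ≡⟨ inverseˡ-unique _ _ (Z-recurrence n bound) ⟩
    - (+ b ℤ.* Z n)                     ≡⟨ cong (λ z → - (+ b ℤ.* z)) (Z-closed n (ℕ.≤-trans (ℕ.n≤1+n _) bound)) ⟩
    - (+ b ℤ.* (sgn n ℤ.* + closed n))    ≡⟨ cong -_ (sym (*-pos-*-swap (sgn n) b (closed n))) ⟩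
    - (sgn n ℤ.* + (b ℕ.* closed n))      ≡⟨ ℤ.neg-distribˡ-* (sgn n) (+ (b ℕ.* closed n)) ⟩
    - sgn n ℤ.* + (b ℕ.* closed n)      ≡⟨ cong (λ x → - sgn n ℤ.* + x) closed-step ⟩
    - sgn n ℤ.* + (a ℕ.* closed (suc n)) ≡⟨ *-pos-*-swap (- sgn n) a (closed (suc n)) ⟩
    + a ℤ.* (sgn (suc n) ℤ.* + closed (suc n)) ∎)
    where
      a = suc (suc (suc (n ℕ.+ m)))
      b = suc (suc n)
      closed-step : b ℕ.* closed n ≡ a ℕ.* closed (suc n)
      closed-step = trans (cong (λ x → b ℕ.* (suc n ! ℕ.* suc m ! ℕ.* x)) (!/-unfold bound))
                          (reorder b a (suc n !) (suc m !) (L !/ a))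
        where
          reorder : ∀ b a f g ρ → b ℕ.* (f ℕ.* g ℕ.* (a ℕ.* ρ)) ≡ a ℕ.* (b ℕ.* f ℕ.* g ℕ.* ρ)
          reorder = NS.solve-∀

module BetaSum (n m : ℕ) where

  M : ℕ
  M = suc (suc (n ℕ.+ m))

  c : ℕ → ℤ
  c l = sgn l ℤ.* + (m C (n ∸ l)) ℤ.* + ((l ℕ.+ suc m) C l)

  R : ℕ → ℕ → ℤ
  R = betaSum M c n

  R-step : ∀ p s → p ℕ.+ s ≤ m → R p (suc s) ≡ R p s - R (suc p) s
  R-step p s p+s≤m = betaSum-step M c n p s (s≤s (s≤s p+n+s≤n+m))
    where
      p+n+s≤n+m : p ℕ.+ n ℕ.+ s ≤ n ℕ.+ m
      p+n+s≤n+m = subst (_≤ n ℕ.+ m) (shuffle n p s) (ℕ.+-monoʳ-≤ n p+s≤m)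
        where
          shuffle : ∀ n p s → n ℕ.+ (p ℕ.+ s) ≡ p ℕ.+ n ℕ.+ s
          shuffle = NS.solve-∀

  R-vanish : ∀ p t → p ℕ.+ suc t ≡ m → t < n → R p (suc t) ≡ + 0
  R-vanish p t p+t+1≡m t<n = begin
    R p (suc t)                                          ≡⟨ sumℤ-cong n shift ⟩
    sumℤ n (λ l → + K ℤ.* (sgn l ℤ.* + (m C (n ∸ l)) ℤ.* + ((p ℕ.+ l) C l))) ≡⟨ sumℤ-*ˡ n (+ K) _ ⟩
    + K ℤ.* negVandermonde m p n                           ≡⟨ cong (λ k → + K ℤ.* negVandermonde k p n) m≡1+p+t ⟩
    + K ℤ.* negVandermonde (suc (p ℕ.+ t)) p n             ≡⟨ cong (ℤ._*_ (+ K)) (negVandermonde-closed p t n) ⟩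
    + K ℤ.* + (t C n)                                      ≡⟨ cong (λ x → + K ℤ.* + x) (k>n⇒nCk≡0 t<n) ⟩
    + K ℤ.* + 0                                            ≡⟨ ℤ.*-zeroʳ (+ K) ⟩
    + 0 ∎
    where
      K = β M p (suc t)
      m≡1+p+t : m ≡ suc (p ℕ.+ t)
      m≡1+p+t = trans (sym p+t+1≡m) (ℕ.+-suc p t)
      reorder : ∀ s x c k → s ℤ.* x ℤ.* (c ℤ.* k) ≡ k ℤ.* (s ℤ.* x ℤ.* c)
      reorder = solve-∀
      shift : ∀ l → l ≤ n → c l ℤ.* + β M (p ℕ.+ l) (suc t) ≡ + K ℤ.* (sgn l ℤ.* + (m C (n ∸ l)) ℤ.* + ((p ℕ.+ l) C l))
      shift l l≤n = begin
        sgn l ℤ.* + (m C (n ∸ l)) ℤ.* + ((l ℕ.+ suc m) C l) ℤ.* + β M (p ℕ.+ l) (suc t)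
          ≡⟨ ℤ.*-assoc (sgn l ℤ.* + (m C (n ∸ l))) _ _ ⟩
        sgn l ℤ.* + (m C (n ∸ l)) ℤ.* (+ ((l ℕ.+ suc m) C l) ℤ.* + β M (p ℕ.+ l) (suc t))
          ≡⟨ cong (ℤ._*_ (sgn l ℤ.* + (m C (n ∸ l)))) (sym (ℤ.pos-* ((l ℕ.+ suc m) C l) (β M (p ℕ.+ l) (suc t)))) ⟩
        sgn l ℤ.* + (m C (n ∸ l)) ℤ.* + (((l ℕ.+ suc m) C l) ℕ.* β M (p ℕ.+ l) (suc t))
          ≡⟨ cong (λ x → sgn l ℤ.* + (m C (n ∸ l)) ℤ.* + x) shifted ⟩
        sgn l ℤ.* + (m C (n ∸ l)) ℤ.* + (((p ℕ.+ l) C l) ℕ.* K)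
          ≡⟨ cong (ℤ._*_ (sgn l ℤ.* + (m C (n ∸ l)))) (ℤ.pos-* ((p ℕ.+ l) C l) K) ⟩
        sgn l ℤ.* + (m C (n ∸ l)) ℤ.* (+ ((p ℕ.+ l) C l) ℤ.* + K)
          ≡⟨ reorder (sgn l) (+ (m C (n ∸ l))) (+ ((p ℕ.+ l) C l)) (+ K) ⟩
        + K ℤ.* (sgn l ℤ.* + (m C (n ∸ l)) ℤ.* + ((p ℕ.+ l) C l)) ∎
        where
          bound : suc (p ℕ.+ l ℕ.+ suc t) ≤ M
          bound = s≤s (ℕ.m≤n⇒m≤1+n (subst (_≤ n ℕ.+ m) l+m≡p+l+t+1 (ℕ.+-monoˡ-≤ m l≤n)))
            where
              shuffle : ∀ l p t → l ℕ.+ (p ℕ.+ suc t) ≡ p ℕ.+ l ℕ.+ suc t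
              shuffle = NS.solve-∀
              l+m≡p+l+t+1 : l ℕ.+ m ≡ p ℕ.+ l ℕ.+ suc t
              l+m≡p+l+t+1 = trans (cong (l ℕ.+_) (sym p+t+1≡m)) (shuffle l p t)
          shifted : ((l ℕ.+ suc m) C l) ℕ.* β M (p ℕ.+ l) (suc t) ≡ ((p ℕ.+ l) C l) ℕ.* K
          shifted = subst (λ k → ((l ℕ.+ suc k) C l) ℕ.* β M (p ℕ.+ l) (suc t) ≡ ((p ℕ.+ l) C l) ℕ.* K)
                          p+t+1≡m (C*β-shift M l p (suc t) bound)

  R-descend : ∀ q a → q ℕ.+ suc a ≡ m → a < n → R q (suc (suc a)) ≡ - R (suc q) (suc a)
  R-descend q a q+a+1≡m a<n = begin
    R q (suc (suc a))               ≡⟨ R-step q (suc a) (ℕ.≤-reflexive q+a+1≡m) ⟩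
    R q (suc a) - R (suc q) (suc a) ≡⟨ cong (_- R (suc q) (suc a)) (R-vanish q a q+a+1≡m a<n) ⟩
    + 0 - R (suc q) (suc a)         ≡⟨ ℤ.+-identityˡ (- R (suc q) (suc a)) ⟩
    - R (suc q) (suc a) ∎

  R-chain : ∀ a q → q ℕ.+ suc a ≡ m → a < n → R q (suc (suc a)) ≡ sgn (suc a) ℤ.* R m 1
  R-chain zero q q+1≡m 0<n = begin
    R q 2          ≡⟨ R-descend q 0 q+1≡m 0<n ⟩
    - R (suc q) 1  ≡⟨ cong (λ p → - R p 1) (trans (ℕ.+-comm 1 q) q+1≡m) ⟩
    - R m 1        ≡⟨ sym (ℤ.-1*i≡-i (R m 1)) ⟩
    sgn 1 ℤ.* R m 1 ∎
  R-chain (suc a) q q+a+2≡m a+1<n = begin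
    R q (suc (suc (suc a)))       ≡⟨ R-descend q (suc a) q+a+2≡m a+1<n ⟩
    - R (suc q) (suc (suc a))     ≡⟨ cong -_ (R-chain a (suc q) (trans (sym (ℕ.+-suc q (suc a))) q+a+2≡m) (ℕ.<-trans (ℕ.n<1+n a) a+1<n)) ⟩
    - (sgn (suc a) ℤ.* R m 1)       ≡⟨ ℤ.neg-distribˡ-* (sgn (suc a)) (R m 1) ⟩
    sgn (suc (suc a)) ℤ.* R m 1 ∎


  open WZ m M using (P; w; z; Z; Z-closed)

  C*β-absorption : ∀ l → suc m ℕ.* (((l ℕ.+ suc m) C l) ℕ.* β M (m ℕ.+ l) 1) ≡ P l ℕ.* w l
  C*β-absorption l = begin
    suc m ℕ.* (((l ℕ.+ suc m) C l) ℕ.* ((m ℕ.+ l) ! ℕ.* 1 ℕ.* (M !/ suc (m ℕ.+ l ℕ.+ 1))))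
      ≡⟨ cong₂ (λ x y → suc m ℕ.* (((l ℕ.+ suc m) C l) ℕ.* (x ! ℕ.* 1 ℕ.* (M !/ suc y))))
               (ℕ.+-comm m l) (trans (ℕ.+-comm (m ℕ.+ l) 1) (cong suc (ℕ.+-comm m l))) ⟩
    suc m ℕ.* (((l ℕ.+ suc m) C l) ℕ.* ((l ℕ.+ m) ! ℕ.* 1 ℕ.* ρ))
      ≡⟨ reorder₁ (suc m) ((l ℕ.+ suc m) C l) ((l ℕ.+ m) !) ρ ⟩
    suc m ℕ.* ((l ℕ.+ suc m) C l) ℕ.* ((l ℕ.+ m) ! ℕ.* ρ)
      ≡⟨ cong (ℕ._* ((l ℕ.+ m) ! ℕ.* ρ)) (C-absorption′ l m) ⟩
    suc (l ℕ.+ m) ℕ.* P l ℕ.* ((l ℕ.+ m) ! ℕ.* ρ)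
      ≡⟨ reorder₂ (suc (l ℕ.+ m)) (P l) ((l ℕ.+ m) !) ρ ⟩
    P l ℕ.* w l ∎
    where
      ρ = M !/ suc (suc (l ℕ.+ m))
      reorder₁ : ∀ a c f ρ → a ℕ.* (c ℕ.* (f ℕ.* 1 ℕ.* ρ)) ≡ a ℕ.* c ℕ.* (f ℕ.* ρ)
      reorder₁ = NS.solve-∀
      reorder₂ : ∀ a p f ρ → a ℕ.* p ℕ.* (f ℕ.* ρ) ≡ p ℕ.* (a ℕ.* f ℕ.* ρ)
      reorder₂ = NS.solve-∀

  c*β≡z : ∀ l → + suc m ℤ.* (c l ℤ.* + β M (m ℕ.+ l) 1) ≡ z n l
  c*β≡z l = begin
    + suc m ℤ.* (sgn l ℤ.* + X ℤ.* + C₁ ℤ.* + B)     ≡⟨ regroup (sgn l) (+ suc m) (+ X) (+ C₁) (+ B) ⟩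
    sgn l ℤ.* + X ℤ.* (+ suc m ℤ.* (+ C₁ ℤ.* + B))   ≡⟨ cong (λ x → sgn l ℤ.* + X ℤ.* (+ suc m ℤ.* x)) (sym (ℤ.pos-* C₁ B)) ⟩
    sgn l ℤ.* + X ℤ.* (+ suc m ℤ.* + (C₁ ℕ.* B))     ≡⟨ cong (ℤ._*_ (sgn l ℤ.* + X)) (sym (ℤ.pos-* (suc m) (C₁ ℕ.* B))) ⟩
    sgn l ℤ.* + X ℤ.* + (suc m ℕ.* (C₁ ℕ.* B))       ≡⟨ cong (λ x → sgn l ℤ.* + X ℤ.* + x) (C*β-absorption l) ⟩
    sgn l ℤ.* + X ℤ.* + (P l ℕ.* w l)                ≡⟨ ℤ.*-assoc (sgn l) (+ X) _ ⟩
    sgn l ℤ.* (+ X ℤ.* + (P l ℕ.* w l))              ≡⟨ cong (ℤ._*_ (sgn l)) (sym (ℤ.pos-* X (P l ℕ.* w l))) ⟩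
    sgn l ℤ.* + (X ℕ.* (P l ℕ.* w l))                ≡⟨ cong (λ x → sgn l ℤ.* + x) (sym (ℕ.*-assoc X (P l) (w l))) ⟩
    z n l ∎
    where
      X = m C (n ∸ l)
      C₁ = (l ℕ.+ suc m) C l
      B = β M (m ℕ.+ l) 1
      regroup : ∀ s c x y b → c ℤ.* (s ℤ.* x ℤ.* y ℤ.* b) ≡ s ℤ.* x ℤ.* (c ℤ.* (y ℤ.* b))
      regroup = solve-∀

  R-corner : R m 1 ≡ sgn n ℤ.* + (suc n ! ℕ.* m !)
  R-corner = ℤ.*-cancelˡ-≡ (+ suc m) _ _ (begin
    + suc m ℤ.* R m 1                                   ≡⟨ sym (sumℤ-*ˡ n (+ suc m) _) ⟩
    sumℤ n (λ l → + suc m ℤ.* (c l ℤ.* + β M (m ℕ.+ l) 1)) ≡⟨ sumℤ-cong n (λ l _ → c*β≡z l) ⟩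
    Z n                                                 ≡⟨ Z-closed n ℕ.≤-refl ⟩
    sgn n ℤ.* + (suc n ! ℕ.* suc m ! ℕ.* (M !/ M))      ≡⟨ cong (λ x → sgn n ℤ.* + (suc n ! ℕ.* suc m ! ℕ.* x)) (!/-diagonal M) ⟩
    sgn n ℤ.* + (suc n ! ℕ.* suc m ! ℕ.* 1)             ≡⟨ cong (λ x → sgn n ℤ.* + x) (reorder (suc n !) m (m !)) ⟩
    sgn n ℤ.* + (suc m ℕ.* (suc n ! ℕ.* m !))           ≡⟨ *-pos-*-swap (sgn n) (suc m) (suc n ! ℕ.* m !) ⟩
    + suc m ℤ.* (sgn n ℤ.* + (suc n ! ℕ.* m !)) ∎)
    where
      reorder : ∀ f m g → f ℕ.* (suc m ℕ.* g) ℕ.* 1 ≡ suc m ℕ.* (f ℕ.* g)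
      reorder = NS.solve-∀

  R-closed : ∀ q a → q ℕ.+ suc a ≡ m → a < n →
    R q (suc (suc a)) ≡ sgn (suc a) ℤ.* (sgn n ℤ.* + (suc n ! ℕ.* m !))
  R-closed q a q+a+1≡m a<n = trans (R-chain a q q+a+1≡m a<n) (cong (ℤ._*_ (sgn (suc a))) R-corner)

toℚᵘ-/ : ∀ x d .{{_ : NonZero d}} → toℚᵘ (x / d) ℚᵘ.≃ (x ℚᵘ./ d)
toℚᵘ-/ x (suc d) = toℚᵘ-fromℚᵘ (ℚᵘ.mkℚᵘ x d)

/-cross : ∀ x y d e .{{_ : NonZero d}} .{{_ : NonZero e}} → x ℤ.* + e ≡ y ℤ.* + d → x / d ≡ y / e
/-cross x y (suc d) (suc e) eq =
  toℚᵘ-injective (ℚᵘ.≃-trans (toℚᵘ-/ x (suc d)) (ℚᵘ.≃-trans (ℚᵘ.*≡* eq) (ℚᵘ.≃-sym (toℚᵘ-/ y (suc e)))))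

/-*-/ : ∀ x y d e .{{_ : NonZero d}} .{{_ : NonZero e}} →
  (x / d) ℚ.* (y / e) ≡ _/_ (x ℤ.* y) (d ℕ.* e) {{ℕ.m*n≢0 d e}}
/-*-/ x y (suc d) (suc e) = toℚᵘ-injective (ℚᵘ.≃-trans (toℚᵘ-homo-* (x / suc d) (y / suc e))
  (ℚᵘ.≃-trans (ℚᵘ.*-cong (toℚᵘ-/ x (suc d)) (toℚᵘ-/ y (suc e))) (ℚᵘ.≃-sym (toℚᵘ-/ (x ℤ.* y) (suc d ℕ.* suc e)))))

/-+-/ : ∀ x y d .{{_ : NonZero d}} → x / d ℚ.+ y / d ≡ (x ℤ.+ y) / d
/-+-/ x y (suc d) = toℚᵘ-injective (ℚᵘ.≃-trans (toℚᵘ-homo-+ (x / suc d) (y / suc d))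
  (ℚᵘ.≃-trans (ℚᵘ.+-cong (toℚᵘ-/ x (suc d)) (toℚᵘ-/ y (suc d)))
    (ℚᵘ.≃-trans (ℚᵘ.*≡* cross) (ℚᵘ.≃-sym (toℚᵘ-/ (x ℤ.+ y) (suc d))))))
  where
    D = + suc d
    cross : (x ℤ.* D ℤ.+ y ℤ.* D) ℤ.* D ≡ (x ℤ.+ y) ℤ.* + (suc d ℕ.* suc d)
    cross = trans (factor x y D) (cong ((x ℤ.+ y) ℤ.*_) (sym (ℤ.pos-* (suc d) (suc d))))
      where
        factor : ∀ x y D → (x ℤ.* D ℤ.+ y ℤ.* D) ℤ.* D ≡ (x ℤ.+ y) ℤ.* (D ℤ.* D)
        factor = solve-∀

sumTo-cong : ∀ n {f g : ℕ → ℚ} → (∀ l → l ≤ n → f l ≡ g l) → sumTo n f ≡ sumTo n g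
sumTo-cong zero f≡g = f≡g 0 z≤n
sumTo-cong (suc n) f≡g =
  cong₂ ℚ._+_ (sumTo-cong n (λ l l≤n → f≡g l (ℕ.m≤n⇒m≤1+n l≤n))) (f≡g (suc n) ℕ.≤-refl)

sumTo-/ : ∀ n (N : ℕ → ℤ) d .{{_ : NonZero d}} → sumTo n (λ l → N l / d) ≡ sumℤ n N / d
sumTo-/ zero N d = refl
sumTo-/ (suc n) N d = trans (cong (ℚ._+ (N (suc n) / d)) (sumTo-/ n N d)) (/-+-/ (sumℤ n N) (N (suc n)) d)

common-denominator : ∀ (x : ℤ) c₁ c₂ f X M k → X ≤ M →
  (x / suc k) * (+ c₁ / 1) * (+ c₂ / 1) * ((+ f) /fact X)
    ≡ _/_ (x ℤ.* + c₁ ℤ.* + c₂ ℤ.* + (f ℕ.* (M !/ X))) (suc k ℕ.* M !) {{ℕ.m*n≢0 (suc k) (M !) {{_}} {{M !≢0}}}}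
common-denominator x c₁ c₂ f X M k X≤M = begin
  (x / suc k) * (+ c₁ / 1) * (+ c₂ / 1) * ((+ f) /fact X)
    ≡⟨ cong (λ q → q * (+ c₂ / 1) * ((+ f) /fact X)) (/-*-/ x (+ c₁) (suc k) 1) ⟩
  ((x ℤ.* + c₁) / (suc k ℕ.* 1)) * (+ c₂ / 1) * ((+ f) /fact X)
    ≡⟨ cong (_* ((+ f) /fact X)) (/-*-/ (x ℤ.* + c₁) (+ c₂) (suc k ℕ.* 1) 1) ⟩
  ((x ℤ.* + c₁ ℤ.* + c₂) / (suc k ℕ.* 1 ℕ.* 1)) * ((+ f) /fact X)
    ≡⟨ /-*-/ (x ℤ.* + c₁ ℤ.* + c₂) (+ f) (suc k ℕ.* 1 ℕ.* 1) (X !) ⟩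
  (y ℤ.* + f) / (suc k ℕ.* 1 ℕ.* 1 ℕ.* X !)
    ≡⟨ /-cross (y ℤ.* + f) (y ℤ.* + (f ℕ.* (M !/ X))) (suc k ℕ.* 1 ℕ.* 1 ℕ.* X !) (suc k ℕ.* M !) cross ⟩
  (y ℤ.* + (f ℕ.* (M !/ X))) / (suc k ℕ.* M !) ∎
  where
    y = x ℤ.* + c₁ ℤ.* + c₂
    instance
      X!≢0 = X !≢0
      k*X!≢0 : NonZero (suc k ℕ.* 1 ℕ.* 1 ℕ.* X !)
      k*X!≢0 = ℕ.m*n≢0 (suc k ℕ.* 1 ℕ.* 1) (X !)
      k*M!≢0 : NonZero (suc k ℕ.* M !)
      k*M!≢0 = ℕ.m*n≢0 (suc k) (M !) {{_}} {{M !≢0}}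
    cross : y ℤ.* + f ℤ.* + (suc k ℕ.* M !) ≡ y ℤ.* + (f ℕ.* (M !/ X)) ℤ.* + (suc k ℕ.* 1 ℕ.* 1 ℕ.* X !)
    cross = begin
      y ℤ.* + f ℤ.* + (suc k ℕ.* M !)
        ≡⟨ cong (λ z → y ℤ.* + f ℤ.* + (suc k ℕ.* z)) (sym (!*!/≡! X≤M)) ⟩
      y ℤ.* + f ℤ.* + (suc k ℕ.* (X ! ℕ.* ρ))
        ≡⟨ cong (y ℤ.* + f ℤ.*_) (trans (ℤ.pos-* (suc k) _) (cong (+ suc k ℤ.*_) (ℤ.pos-* (X !) ρ))) ⟩
      y ℤ.* + f ℤ.* (+ suc k ℤ.* (+ (X !) ℤ.* + ρ))
        ≡⟨ reorder y (+ f) (+ suc k) (+ (X !)) (+ ρ) ⟩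
      y ℤ.* (+ f ℤ.* + ρ) ℤ.* (+ (suc k ℕ.* 1 ℕ.* 1) ℤ.* + (X !))
        ≡⟨ cong₂ (λ u v → y ℤ.* u ℤ.* v) (sym (ℤ.pos-* f ρ)) (sym (ℤ.pos-* (suc k ℕ.* 1 ℕ.* 1) (X !))) ⟩
      y ℤ.* + (f ℕ.* ρ) ℤ.* + (suc k ℕ.* 1 ℕ.* 1 ℕ.* X !) ∎
      where
        ρ = M !/ X
        reorder : ∀ y f k x ρ → y ℤ.* f ℤ.* (k ℤ.* (x ℤ.* ρ)) ≡ y ℤ.* (f ℤ.* ρ) ℤ.* (k ℤ.* + 1 ℤ.* + 1 ℤ.* x)
        reorder = solve-∀

module Summand (a i-1 j-1 : ℕ) where

  i j n m : ℕ
  i = suc i-1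
  j = suc j-1
  n = i ℕ.+ a
  m = j ℕ.+ a

  open BetaSum n m

  x : ℕ → ℤ
  x l = sgn (l ℕ.+ j ℕ.+ 1) ℤ.* (+ j ℤ.- + i)

  c₁ c₂ f X : ℕ → ℕ
  c₁ l = (j ℕ.+ a) C (i ℕ.+ a ∸ l)
  c₂ l = (l ℕ.+ j ℕ.+ a ℕ.+ 1) C l
  f l = (a ℕ.+ 2) ! ℕ.* (l ℕ.+ j ∸ 1) !
  X l = l ℕ.+ j ℕ.+ a ℕ.+ 2

  N : ℕ → ℤ
  N l = sgn (suc j) ℤ.* (+ j ℤ.- + i) ℤ.* (c l ℤ.* + β M (j-1 ℕ.+ l) (suc (suc a)))

  RHS : ℤ
  RHS = sgn (i ℕ.+ j) ℤ.* (+ j ℤ.- + i) ℤ.* + ((a ℕ.+ i) ! ℕ.* (a ℕ.+ j) !)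

  X≤M : ∀ l → l ≤ n → X l ≤ M
  X≤M l l≤n = ℕ.≤-trans (ℕ.+-monoˡ-≤ 2 (ℕ.+-monoˡ-≤ a (ℕ.+-monoˡ-≤ j l≤n))) (ℕ.≤-reflexive (shuffle n j a))
    where
      shuffle : ∀ n j a → n ℕ.+ j ℕ.+ a ℕ.+ 2 ≡ suc (suc (n ℕ.+ (j ℕ.+ a)))
      shuffle = NS.solve-∀

  M-index : 2 ℕ.* a ℕ.+ i ℕ.+ j ℕ.+ 2 ≡ M
  M-index = shuffle a i-1 j-1
    where
      shuffle : ∀ a i-1 j-1 → 2 ℕ.* a ℕ.+ suc i-1 ℕ.+ suc j-1 ℕ.+ 2 ≡ suc (suc (suc i-1 ℕ.+ a ℕ.+ (suc j-1 ℕ.+ a)))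
      shuffle = NS.solve-∀

  f*!/≡β : ∀ l → f l ℕ.* (M !/ X l) ≡ β M (j-1 ℕ.+ l) (suc (suc a))
  f*!/≡β l = begin
    (a ℕ.+ 2) ! ℕ.* (l ℕ.+ j ∸ 1) ! ℕ.* (M !/ X l)
      ≡⟨ cong₂ (λ u v → u ! ℕ.* v ! ℕ.* (M !/ X l)) (ℕ.+-comm a 2) (trans (cong (_∸ 1) (ℕ.+-suc l j-1)) (ℕ.+-comm l j-1)) ⟩
    suc (suc a) ! ℕ.* (j-1 ℕ.+ l) ! ℕ.* (M !/ X l)
      ≡⟨ cong₂ (λ u v → u ℕ.* (M !/ v)) (ℕ.*-comm (suc (suc a) !) ((j-1 ℕ.+ l) !)) (shuffle l j-1 a) ⟩
    β M (j-1 ℕ.+ l) (suc (suc a)) ∎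
    where
      shuffle : ∀ l j-1 a → l ℕ.+ suc j-1 ℕ.+ a ℕ.+ 2 ≡ suc (j-1 ℕ.+ l ℕ.+ suc (suc a))
      shuffle = NS.solve-∀

  numerator : ∀ l → x l ℤ.* + c₁ l ℤ.* + c₂ l ℤ.* + (f l ℕ.* (M !/ X l)) ≡ N l
  numerator l = begin
    x l ℤ.* + c₁ l ℤ.* + c₂ l ℤ.* + (f l ℕ.* (M !/ X l))
      ≡⟨ cong₂ (λ s k → s ℤ.* (+ j ℤ.- + i) ℤ.* + c₁ l ℤ.* + (k C l) ℤ.* + (f l ℕ.* (M !/ X l))) sign c₂-index ⟩
    sgn l ℤ.* sgn (suc j) ℤ.* (+ j ℤ.- + i) ℤ.* + c₁ l ℤ.* + ((l ℕ.+ suc m) C l) ℤ.* + (f l ℕ.* (M !/ X l))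
      ≡⟨ cong (λ b → sgn l ℤ.* sgn (suc j) ℤ.* (+ j ℤ.- + i) ℤ.* + c₁ l ℤ.* + ((l ℕ.+ suc m) C l) ℤ.* + b) (f*!/≡β l) ⟩
    sgn l ℤ.* sgn (suc j) ℤ.* (+ j ℤ.- + i) ℤ.* + c₁ l ℤ.* + ((l ℕ.+ suc m) C l) ℤ.* + β M (j-1 ℕ.+ l) (suc (suc a))
      ≡⟨ regroup (sgn l) (sgn (suc j)) (+ j ℤ.- + i) (+ c₁ l) (+ ((l ℕ.+ suc m) C l)) (+ β M (j-1 ℕ.+ l) (suc (suc a))) ⟩
    N l ∎
    where
      regroup : ∀ s σ d x y b → s ℤ.* σ ℤ.* d ℤ.* x ℤ.* y ℤ.* b ≡ σ ℤ.* d ℤ.* (s ℤ.* x ℤ.* y ℤ.* b)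
      regroup = solve-∀
      sign : sgn (l ℕ.+ j ℕ.+ 1) ≡ sgn l ℤ.* sgn (suc j)
      sign = trans (cong sgn (ℕ.+-assoc l j 1)) (trans (cong (λ k → sgn (l ℕ.+ k)) (ℕ.+-comm j 1)) (sgn-+ l (suc j)))
      c₂-index : l ℕ.+ j ℕ.+ a ℕ.+ 1 ≡ l ℕ.+ suc m
      c₂-index = shuffle l j a
        where
          shuffle : ∀ l j a → l ℕ.+ j ℕ.+ a ℕ.+ 1 ≡ l ℕ.+ suc (j ℕ.+ a)
          shuffle = NS.solve-∀

  sum-N : sumℤ n N ≡ RHS ℤ.* + suc n
  sum-N = begin
    sumℤ n N
      ≡⟨ sumℤ-*ˡ n (sgn (suc j) ℤ.* (+ j ℤ.- + i)) _ ⟩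
    sgn (suc j) ℤ.* (+ j ℤ.- + i) ℤ.* R j-1 (suc (suc a))
      ≡⟨ cong (sgn (suc j) ℤ.* (+ j ℤ.- + i) ℤ.*_) (R-closed j-1 a (ℕ.+-suc j-1 a) (s≤s (ℕ.m≤n+m a i-1))) ⟩
    sgn (suc j) ℤ.* (+ j ℤ.- + i) ℤ.* (sgn (suc a) ℤ.* (sgn n ℤ.* + (suc n ! ℕ.* m !)))
      ≡⟨ cong (λ r → sgn (suc j) ℤ.* (+ j ℤ.- + i) ℤ.* (sgn (suc a) ℤ.* (sgn n ℤ.* r)))
              (trans (cong +_ (ℕ.*-assoc (suc n) (n !) (m !))) (ℤ.pos-* (suc n) (n ! ℕ.* m !))) ⟩
    sgn (suc j) ℤ.* (+ j ℤ.- + i) ℤ.* (sgn (suc a) ℤ.* (sgn n ℤ.* (+ suc n ℤ.* + (n ! ℕ.* m !))))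
      ≡⟨ regroup (sgn (suc j)) (+ j ℤ.- + i) (sgn (suc a)) (sgn n) (+ suc n) (+ (n ! ℕ.* m !)) ⟩
    sgn (suc j) ℤ.* sgn (suc a) ℤ.* sgn n ℤ.* (+ j ℤ.- + i) ℤ.* + (n ! ℕ.* m !) ℤ.* + suc n
      ≡⟨ cong₂ (λ s F → s ℤ.* (+ j ℤ.- + i) ℤ.* + F ℤ.* + suc n) (sgn-parity i j a)
               (cong₂ (λ u v → u ! ℕ.* v !) (ℕ.+-comm i a) (ℕ.+-comm j a)) ⟩
    RHS ℤ.* + suc n ∎
    where
      regroup : ∀ σ d σa σn k F → σ ℤ.* d ℤ.* (σa ℤ.* (σn ℤ.* (k ℤ.* F))) ≡ σ ℤ.* σa ℤ.* σn ℤ.* d ℤ.* F ℤ.* k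
      regroup = solve-∀

  cross : sumℤ n N ℤ.* + ((2 ℕ.* a ℕ.+ i ℕ.+ j ℕ.+ 2) !) ≡ RHS ℤ.* + (suc n ℕ.* M !)
  cross = begin
    sumℤ n N ℤ.* + ((2 ℕ.* a ℕ.+ i ℕ.+ j ℕ.+ 2) !) ≡⟨ cong₂ (λ s k → s ℤ.* + (k !)) sum-N M-index ⟩
    RHS ℤ.* + suc n ℤ.* + (M !)                    ≡⟨ ℤ.*-assoc RHS (+ suc n) (+ (M !)) ⟩
    RHS ℤ.* (+ suc n ℤ.* + (M !))                  ≡⟨ cong (RHS ℤ.*_) (sym (ℤ.pos-* (suc n) (M !))) ⟩
    RHS ℤ.* + (suc n ℕ.* M !) ∎

lemma14 : (a i j : ℕ) → 1 ℕ.≤ i → 1 ℕ.≤ j →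
    sumTo (i ℕ.+ a) (λ ℓ →
        ((sgn (ℓ ℕ.+ j ℕ.+ 1) ℤ.* (+ j ℤ.- + i)) / suc (i ℕ.+ a))
      * ((+ ((j ℕ.+ a) C (i ℕ.+ a ∸ ℓ))) / 1)
      * ((+ ((ℓ ℕ.+ j ℕ.+ a ℕ.+ 1) C ℓ)) / 1)
      * ((+ ((a ℕ.+ 2) ! ℕ.* (ℓ ℕ.+ j ∸ 1) !)) /fact (ℓ ℕ.+ j ℕ.+ a ℕ.+ 2)))
    ≡ ((sgn (i ℕ.+ j) ℤ.* (+ j ℤ.- + i) ℤ.* + ((a ℕ.+ i) ! ℕ.* (a ℕ.+ j) !))
        /fact (2 ℕ.* a ℕ.+ i ℕ.+ j ℕ.+ 2))
lemma14 a (suc i-1) (suc j-1) _ _ = begin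
  sumTo n (λ l → x l / suc n * (+ c₁ l / 1) * (+ c₂ l / 1) * ((+ f l) /fact X l))
    ≡⟨ sumTo-cong n (λ l l≤n → trans (common-denominator (x l) (c₁ l) (c₂ l) (f l) (X l) M n (X≤M l l≤n))
                                      (cong (λ y → y / D) (numerator l))) ⟩
  sumTo n (λ l → N l / D)
    ≡⟨ sumTo-/ n N D ⟩
  sumℤ n N / D
    ≡⟨ /-cross (sumℤ n N) RHS D ((2 ℕ.* a ℕ.+ i ℕ.+ j ℕ.+ 2) !) cross ⟩
  RHS /fact (2 ℕ.* a ℕ.+ i ℕ.+ j ℕ.+ 2) ∎
  where
    open Summand a i-1 j-1
    open BetaSum n m using (M)
    D = suc n ℕ.* M !
    instance
      D≢0 : NonZero D
      D≢0 = ℕ.m*n≢0 (suc n) (M !) {{_}} {{M !≢0}}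
      M′!≢0 = (2 ℕ.* a ℕ.+ i ℕ.+ j ℕ.+ 2) !≢0
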